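{- Let $G$ be a graph with $n$ nodes and $m$ edges, let $\mathcal{S}=a_1:\ldots:a_\ell$ be a hierarchy with integers $a_i\ge 2$, and let $1\le h\le\ell$. Solving the partitioning subproblems of the $h$ upper layers (layers $\ell,\ell-1,\ldots,\ell-h+1$) of the online recursive multi-section with Fennel and those of the remaining layers with Hashing has overall time complexity $O\big(mh + n\sum_{i=\ell-h+1}^{\ell}a_i\big)$.
   Context: One-pass streaming model: nodes of $G$ arrive one at a time together with their neighborhood $N(u)$ and must be permanently assigned to a block on arrival. A hierarchy $\mathcal{S}=a_1:\ldots:a_\ell$ defines a tree of blocks: layer $\ell$ has $a_\ell$ blocks; each block of layer $i>1$ has $a_{i-1}$ sub-blocks in layer $i-1$; layer $1$ contains the $k=\prod a_i$ final blocks. Online recursive multi-section: when node $u$ arrives, for $i=\ell,\ldots,1$ it chooses one of the $a_i$ candidate blocks of layer $i$ (all top-layer blocks if $i=\ell$, otherwise the sub-blocks of the block chosen at layer $i+1$) and assigns $u$ to it; weights of all blocks are maintained. Fennel chooses the candidate $W$ maximizing $|W\cap N(u)|-\alpha_i\gamma|W|^{\gamma-1}$ (constants $\alpha_i,\gamma$), which costs $O(|N(u)|+a_i)$ time per layer. Hashing assigns a node to a block via a hash function in $O(1)$ time; in the hybrid, the remaining lower layers are handled by a single Hashing operation per node. -}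

module Defs where

open import Data.Nat using (ℕ; zero; suc; _+_; _*_; _∸_; _≤ᵇ_; _<ᵇ_)
open import Data.Fin using (Fin; toℕ)
open import Data.Bool using (Bool; true; false; if_then_else_)
open import Relation.Binary.PropositionalEquality using (_≡_)

sumFin : (n : ℕ) → (Fin n → ℕ) → ℕ
sumFin zero    f = 0
sumFin (suc n) f = f Fin.zero + sumFin n (λ i → f (Fin.suc i))

bool→ℕ : Bool → ℕ
bool→ℕ true  = 1
bool→ℕ false = 0

record Graph : Set where
  field
    n      : ℕ
    adj    : Fin n → Fin n → Bool
    sym    : ∀ u v → adj u v ≡ adj v u
    irrefl : ∀ u → adj u u ≡ false
open Graph public

deg : (G : Graph) → Fin (n G) → ℕ
deg G u = sumFin (n G) (λ v → bool→ℕ (adj G u v))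

edges : Graph → ℕ
edges G = sumFin (n G) (λ u → sumFin (n G) (λ v →
            if toℕ u <ᵇ toℕ v then bool→ℕ (adj G u v) else 0))

-- Hierarchy S = a_1 : ... : a_ℓ, with layer (toℕ i + 1) having parameter a i.
-- Layer index i : Fin ℓ is among the h upper layers ℓ-h+1..ℓ iff ℓ ∸ h ≤ toℕ i.
isUpper : (ℓ h : ℕ) → Fin ℓ → Bool
isUpper ℓ h i = ℓ ∸ h ≤ᵇ toℕ i

sumUpper : (ℓ h : ℕ) → (Fin ℓ → ℕ) → ℕ
sumUpper ℓ h g = sumFin ℓ (λ i → if isUpper ℓ h i then g i else 0)

-- Total running time of the hybrid: for every node u, the Fennel cost
-- F i u of each of the h upper layers i, plus the cost H u of the single
-- Hashing operation handling the remaining layers.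
hybridCost : (G : Graph) (ℓ h : ℕ) →
             (Fin ℓ → Fin (n G) → ℕ) → (Fin (n G) → ℕ) → ℕ
hybridCost G ℓ h F H =
  sumFin (n G) (λ u → sumUpper ℓ h (λ i → F i u) + H u)

{-# OPTIONS --safe #-}
-- Per node, each of the h Fennel layers i costs at most c (deg u + a i) and the single
-- Hashing step costs c, so node u costs at most c (h deg u + Σ_upper a + 1).  Summing over
-- the nodes, the handshake lemma Σ_u deg u = 2m turns the first term into 2 c m h, and
-- since Σ_upper a ≥ h ≥ 1 the Hashing term c n is absorbed into c n Σ_upper a.
module Submission where

open import Defs
open import Data.Nat using (ℕ; _+_; _*_; _≤_)
open import Data.Fin using (Fin)
open import Data.Product using (∃-syntax)

open import Data.Nat using (zero; suc; _∸_; _<_; _≤ᵇ_; _<ᵇ_; z≤n; s≤s)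
open import Data.Nat.Properties
open import Data.Nat.Tactic.RingSolver using (solve-∀)
open import Data.Fin using (toℕ)
open import Data.Fin.Properties using (toℕ-injective)
open import Data.Bool using (true; false; if_then_else_)
open import Data.Product using (_,_)
open import Relation.Binary using (tri<; tri≈; tri>)
open import Relation.Binary.PropositionalEquality
  using (_≡_; refl; trans; cong; cong₂; module ≡-Reasoning)
  renaming (sym to ≡-sym)

sumFin-cong : ∀ n {f g : Fin n → ℕ} → (∀ i → f i ≡ g i) → sumFin n f ≡ sumFin n g
sumFin-cong zero    f≡g = refl
sumFin-cong (suc n) f≡g = cong₂ _+_ (f≡g Fin.zero) (sumFin-cong n (λ i → f≡g (Fin.suc i)))

sumFin-mono : ∀ n {f g : Fin n → ℕ} → (∀ i → f i ≤ g i) → sumFin n f ≤ sumFin n g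
sumFin-mono zero    f≤g = z≤n
sumFin-mono (suc n) f≤g = +-mono-≤ (f≤g Fin.zero) (sumFin-mono n (λ i → f≤g (Fin.suc i)))

sumFin-+ : ∀ n (f g : Fin n → ℕ) →
           sumFin n (λ i → f i + g i) ≡ sumFin n f + sumFin n g
sumFin-+ zero    f g = refl
sumFin-+ (suc n) f g = begin
  (f₀ + g₀) + sumFin n (λ i → f (Fin.suc i) + g (Fin.suc i))
    ≡⟨ cong ((f₀ + g₀) +_) (sumFin-+ n (λ i → f (Fin.suc i)) (λ i → g (Fin.suc i))) ⟩
  (f₀ + g₀) + (Σf + Σg)
    ≡⟨ +-+-interchange f₀ g₀ Σf Σg ⟩
  (f₀ + Σf) + (g₀ + Σg) ∎
  where
  open ≡-Reasoning
  f₀ = f Fin.zero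
  g₀ = g Fin.zero
  Σf = sumFin n (λ i → f (Fin.suc i))
  Σg = sumFin n (λ i → g (Fin.suc i))
  +-+-interchange : ∀ a b c d → (a + b) + (c + d) ≡ (a + c) + (b + d)
  +-+-interchange = solve-∀

sumFin-*ˡ : ∀ n c (f : Fin n → ℕ) → sumFin n (λ i → c * f i) ≡ c * sumFin n f
sumFin-*ˡ zero    c f = ≡-sym (*-zeroʳ c)
sumFin-*ˡ (suc n) c f = trans (cong (c * f Fin.zero +_) (sumFin-*ˡ n c (λ i → f (Fin.suc i))))
                              (≡-sym (*-distribˡ-+ c (f Fin.zero) _))

sumFin-const : ∀ n k → sumFin n (λ _ → k) ≡ n * k
sumFin-const zero    k = refl
sumFin-const (suc n) k = cong (k +_) (sumFin-const n k)

sumFin-swap : ∀ n m (f : Fin n → Fin m → ℕ) →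
              sumFin n (λ i → sumFin m (f i)) ≡ sumFin m (λ j → sumFin n (λ i → f i j))
sumFin-swap zero    m f = ≡-sym (trans (sumFin-const m 0) (*-zeroʳ m))
sumFin-swap (suc n) m f =
  trans (cong (sumFin m (f Fin.zero) +_) (sumFin-swap n m (λ i → f (Fin.suc i))))
        (≡-sym (sumFin-+ m (f Fin.zero) (λ j → sumFin n (λ i → f (Fin.suc i) j))))

sumFin-affine : ∀ n c h k (f : Fin n → ℕ) →
                sumFin n (λ i → c * (h * f i + k)) ≡ c * (h * sumFin n f + n * k)
sumFin-affine zero    c h k f = ≡-sym (trans (cong (λ x → c * (x + 0)) (*-zeroʳ h)) (*-zeroʳ c))
sumFin-affine (suc n) c h k f =
  trans (cong (c * (h * f Fin.zero + k) +_) (sumFin-affine n c h k (λ i → f (Fin.suc i))))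
        (distrib c h k (f Fin.zero) (sumFin n (λ i → f (Fin.suc i))) (n * k))
  where
  distrib : ∀ c h k x s t → c * (h * x + k) + c * (h * s + t) ≡ c * (h * (x + s) + (k + t))
  distrib = solve-∀

<⇒<ᵇ≡true : ∀ {m n} → m < n → (m <ᵇ n) ≡ true
<⇒<ᵇ≡true {zero}  {suc n} _         = refl
<⇒<ᵇ≡true {suc m} {suc n} (s≤s m<n) = <⇒<ᵇ≡true m<n

≤⇒>ᵇ≡false : ∀ {m n} → n ≤ m → (m <ᵇ n) ≡ false
≤⇒>ᵇ≡false {m}     {zero}  _         = refl
≤⇒>ᵇ≡false {suc m} {suc n} (s≤s n≤m) = ≤⇒>ᵇ≡false n≤m

orderedEdge : (G : Graph) → Fin (n G) → Fin (n G) → ℕ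
orderedEdge G u v = if toℕ u <ᵇ toℕ v then bool→ℕ (adj G u v) else 0

adj≡orderedEdge+orderedEdge : (G : Graph) (u v : Fin (n G)) →
                              bool→ℕ (adj G u v) ≡ orderedEdge G u v + orderedEdge G v u
adj≡orderedEdge+orderedEdge G u v with <-cmp (toℕ u) (toℕ v)
... | tri< u<v _ _
  rewrite <⇒<ᵇ≡true u<v | ≤⇒>ᵇ≡false (<⇒≤ u<v) = ≡-sym (+-identityʳ _)
... | tri> _ _ v<u
  rewrite ≤⇒>ᵇ≡false (<⇒≤ v<u) | <⇒<ᵇ≡true v<u = cong bool→ℕ (Graph.sym G u v)
... | tri≈ _ u≡v _
  rewrite toℕ-injective u≡v | irrefl G v | ≤⇒>ᵇ≡false (≤-refl {toℕ v}) = refl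

handshake : (G : Graph) → sumFin (n G) (deg G) ≡ 2 * edges G
handshake G = begin
  sumFin N (deg G)
    ≡⟨ sumFin-cong N (λ u → sumFin-cong N (adj≡orderedEdge+orderedEdge G u)) ⟩
  sumFin N (λ u → sumFin N (λ v → orderedEdge G u v + orderedEdge G v u))
    ≡⟨ sumFin-cong N (λ u → sumFin-+ N (orderedEdge G u) (λ v → orderedEdge G v u)) ⟩
  sumFin N (λ u → edgesFrom u + sumFin N (λ v → orderedEdge G v u))
    ≡⟨ sumFin-+ N edgesFrom (λ u → sumFin N (λ v → orderedEdge G v u)) ⟩
  edges G + sumFin N (λ u → sumFin N (λ v → orderedEdge G v u))
    ≡⟨ cong (edges G +_) (≡-sym (sumFin-swap N N (orderedEdge G))) ⟩
  edges G + edges G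
    ≡⟨ cong (edges G +_) (≡-sym (+-identityʳ _)) ⟩
  2 * edges G ∎
  where
  open ≡-Reasoning
  N = n G
  edgesFrom : Fin (n G) → ℕ
  edgesFrom u = sumFin N (orderedEdge G u)

sumFin-≤ᵇ-const : ∀ ℓ k x → sumFin ℓ (λ i → if k ≤ᵇ toℕ i then x else 0) ≡ (ℓ ∸ k) * x
sumFin-≤ᵇ-const zero    zero    x = refl
sumFin-≤ᵇ-const zero    (suc k) x = refl
sumFin-≤ᵇ-const (suc ℓ) zero    x = cong (x +_) (sumFin-≤ᵇ-const ℓ zero x)
sumFin-≤ᵇ-const (suc ℓ) (suc k) x =
  trans (sumFin-cong ℓ (λ i → cong (λ b → if b then x else 0) (suc≤ᵇsuc k (toℕ i))))
        (sumFin-≤ᵇ-const ℓ k x)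
  where
  suc≤ᵇsuc : ∀ k y → (suc k ≤ᵇ suc y) ≡ (k ≤ᵇ y)
  suc≤ᵇsuc zero    y = refl
  suc≤ᵇsuc (suc k) y = refl

sumUpper-const : ∀ {ℓ h} → h ≤ ℓ → ∀ k → sumUpper ℓ h (λ _ → k) ≡ h * k
sumUpper-const {ℓ} {h} h≤ℓ k =
  trans (sumFin-≤ᵇ-const ℓ (ℓ ∸ h) k) (cong (_* k) (m∸[m∸n]≡n h≤ℓ))

sumUpper-mono : ∀ ℓ h {f g : Fin ℓ → ℕ} → (∀ i → f i ≤ g i) → sumUpper ℓ h f ≤ sumUpper ℓ h g
sumUpper-mono ℓ h f≤g = sumFin-mono ℓ (λ i → masked (isUpper ℓ h i) (f≤g i))
  where
  masked : ∀ b {x y} → x ≤ y → (if b then x else 0) ≤ (if b then y else 0)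
  masked true  x≤y = x≤y
  masked false _   = z≤n

sumUpper-+ : ∀ ℓ h (f g : Fin ℓ → ℕ) →
             sumUpper ℓ h (λ i → f i + g i) ≡ sumUpper ℓ h f + sumUpper ℓ h g
sumUpper-+ ℓ h f g =
  trans (sumFin-cong ℓ (λ i → masked (isUpper ℓ h i) (f i) (g i))) (sumFin-+ ℓ _ _)
  where
  masked : ∀ b x y → (if b then x + y else 0) ≡ (if b then x else 0) + (if b then y else 0)
  masked true  x y = refl
  masked false x y = refl

sumUpper-*ˡ : ∀ ℓ h c (f : Fin ℓ → ℕ) → sumUpper ℓ h (λ i → c * f i) ≡ c * sumUpper ℓ h f
sumUpper-*ˡ ℓ h c f =
  trans (sumFin-cong ℓ (λ i → masked (isUpper ℓ h i) (f i))) (sumFin-*ˡ ℓ c _)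
  where
  masked : ∀ b x → (if b then c * x else 0) ≡ c * (if b then x else 0)
  masked true  x = refl
  masked false x = ≡-sym (*-zeroʳ c)

h≤sumUpper : ∀ {ℓ h} (a : Fin ℓ → ℕ) → h ≤ ℓ → (∀ i → 1 ≤ a i) → h ≤ sumUpper ℓ h a
h≤sumUpper {ℓ} {h} a h≤ℓ 1≤a = begin
  h                          ≡⟨ ≡-sym (*-identityʳ h) ⟩
  h * 1                      ≡⟨ ≡-sym (sumUpper-const h≤ℓ 1) ⟩
  sumUpper ℓ h (λ _ → 1)     ≤⟨ sumUpper-mono ℓ h 1≤a ⟩
  sumUpper ℓ h a             ∎
  where open ≤-Reasoning

upperLayersCost-≤ : ∀ {ℓ h} c d (a F : Fin ℓ → ℕ) → h ≤ ℓ → (∀ i → F i ≤ c * (d + a i)) →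
                    sumUpper ℓ h F ≤ c * (h * d + sumUpper ℓ h a)
upperLayersCost-≤ {ℓ} {h} c d a F h≤ℓ F≤ = begin
  sumUpper ℓ h F
    ≤⟨ sumUpper-mono ℓ h F≤ ⟩
  sumUpper ℓ h (λ i → c * (d + a i))
    ≡⟨ sumUpper-*ˡ ℓ h c (λ i → d + a i) ⟩
  c * sumUpper ℓ h (λ i → d + a i)
    ≡⟨ cong (c *_) (sumUpper-+ ℓ h (λ _ → d) a) ⟩
  c * (sumUpper ℓ h (λ _ → d) + sumUpper ℓ h a)
    ≡⟨ cong (λ x → c * (x + sumUpper ℓ h a)) (sumUpper-const h≤ℓ d) ⟩
  c * (h * d + sumUpper ℓ h a) ∎
  where open ≤-Reasoning

nodeCost-≤ : ∀ {ℓ h} c d (a F : Fin ℓ → ℕ) x → h ≤ ℓ → 1 ≤ sumUpper ℓ h a →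
             (∀ i → F i ≤ c * (d + a i)) → x ≤ c →
             sumUpper ℓ h F + x ≤ c * (h * d + 2 * sumUpper ℓ h a)
nodeCost-≤ {ℓ} {h} c d a F x h≤ℓ 1≤S F≤ x≤c = begin
  sumUpper ℓ h F + x
    ≤⟨ +-mono-≤ (upperLayersCost-≤ c d a F h≤ℓ F≤) x≤c ⟩
  c * (h * d + S) + c
    ≡⟨ cong (c * (h * d + S) +_) (≡-sym (*-identityʳ c)) ⟩
  c * (h * d + S) + c * 1
    ≤⟨ +-monoʳ-≤ (c * (h * d + S)) (*-monoʳ-≤ c 1≤S) ⟩
  c * (h * d + S) + c * S
    ≡⟨ absorb c h d S ⟩
  c * (h * d + 2 * S) ∎
  where
  open ≤-Reasoning
  S = sumUpper ℓ h a
  absorb : ∀ c h d S → c * (h * d + S) + c * S ≡ c * (h * d + 2 * S)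
  absorb = solve-∀

theorem3 : (c : ℕ) → ∃[ C ] ((G : Graph) (ℓ : ℕ) (a : Fin ℓ → ℕ) → (∀ i → 2 ≤ a i) →
    (h : ℕ) → 1 ≤ h → h ≤ ℓ →
    (F : Fin ℓ → Fin (n G) → ℕ) → (H : Fin (n G) → ℕ) →
    (∀ i u → F i u ≤ c * (deg G u + a i)) → (∀ u → H u ≤ c) →
    hybridCost G ℓ h F H ≤ C * (edges G * h + n G * sumUpper ℓ h a))
theorem3 c = 2 * c , λ G ℓ a 2≤a h 1≤h h≤ℓ F H F≤ H≤ →
  let S   = sumUpper ℓ h a
      1≤S = ≤-trans 1≤h (h≤sumUpper a h≤ℓ (λ i → ≤-trans (s≤s z≤n) (2≤a i)))
  in begin
  hybridCost G ℓ h F H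
    ≤⟨ sumFin-mono (n G) (λ u →
         nodeCost-≤ c (deg G u) a (λ i → F i u) (H u) h≤ℓ 1≤S (λ i → F≤ i u) (H≤ u)) ⟩
  sumFin (n G) (λ u → c * (h * deg G u + 2 * S))
    ≡⟨ sumFin-affine (n G) c h (2 * S) (deg G) ⟩
  c * (h * sumFin (n G) (deg G) + n G * (2 * S))
    ≡⟨ cong (λ D → c * (h * D + n G * (2 * S))) (handshake G) ⟩
  c * (h * (2 * edges G) + n G * (2 * S))
    ≡⟨ collect c h (edges G) (n G) S ⟩
  2 * c * (edges G * h + n G * S) ∎
  where
  open ≤-Reasoning
  collect : ∀ c h m N S → c * (h * (2 * m) + N * (2 * S)) ≡ 2 * c * (m * h + N * S)
  collect = solve-∀
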